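{- Let $L$ be a residuated lattice and $F,G$ filters of $L$. Then $L=F\oplus G$ if and only if there exists $e\in B(L)$ such that $F=[e)$ and $G=[e^*)$. In particular, if $e,f\in B(L)$ and $L=[e)\oplus[f)$, then $f=e^*$.
   Context: A residuated lattice is an algebra $(L,\wedge,\vee,\odot,\rightarrow,0,1)$ such that $(L,\wedge,\vee,0,1)$ is a bounded lattice, $(L,\odot,1)$ is a commutative monoid, and $x\odot z\le y$ iff $z\le x\rightarrow y$. Write $x^*:=x\rightarrow 0$; $B(L)$ is the set of complemented elements. A filter is a nonempty subset closed under $\odot$ and upward closed; $[x)$ is the filter generated by $x$; $F\vee G$ is the smallest filter containing $F\cup G$. $H=F\oplus G$ means $F\cap G=\{1\}$ and $H=F\vee G$. -}

module Defs where

open import Level using (Level; suc; _⊔_)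
open import Data.Product using (Σ; _×_; ∃; _,_)
open import Data.Sum using (_⊎_)
open import Data.Unit.Polymorphic using (⊤)
open import Relation.Binary.PropositionalEquality using (_≡_)

record ResiduatedLattice (c : Level) : Set (suc c) where
  infixr 6 _∨_
  infixr 7 _∧_
  infixr 8 _⊙_
  infixr 5 _⇒_
  field
    Carrier : Set c
    _∧_ _∨_ _⊙_ _⇒_ : Carrier → Carrier → Carrier
    𝟘 𝟙 : Carrier
    ∧-comm   : ∀ x y → x ∧ y ≡ y ∧ x
    ∨-comm   : ∀ x y → x ∨ y ≡ y ∨ x
    ∧-assoc  : ∀ x y z → (x ∧ y) ∧ z ≡ x ∧ (y ∧ z)
    ∨-assoc  : ∀ x y z → (x ∨ y) ∨ z ≡ x ∨ (y ∨ z)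
    ∧-absorb : ∀ x y → x ∧ (x ∨ y) ≡ x
    ∨-absorb : ∀ x y → x ∨ (x ∧ y) ≡ x
    𝟘-least  : ∀ x → 𝟘 ∧ x ≡ 𝟘
    𝟙-greatest : ∀ x → x ∧ 𝟙 ≡ x
    ⊙-comm   : ∀ x y → x ⊙ y ≡ y ⊙ x
    ⊙-assoc  : ∀ x y z → (x ⊙ y) ⊙ z ≡ x ⊙ (y ⊙ z)
    ⊙-identityʳ : ∀ x → x ⊙ 𝟙 ≡ x

  infix 4 _≤_
  _≤_ : Carrier → Carrier → Set c
  x ≤ y = x ∧ y ≡ x

  field
    residuation⇒ : ∀ x y z → x ⊙ z ≤ y → z ≤ x ⇒ y
    residuation⇐ : ∀ x y z → z ≤ x ⇒ y → x ⊙ z ≤ y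

  _* : Carrier → Carrier
  x * = x ⇒ 𝟘

  InB : Carrier → Set c
  InB e = Σ Carrier λ e' → (e ∧ e' ≡ 𝟘) × (e ∨ e' ≡ 𝟙)

  Subset : Set (suc c)
  Subset = Carrier → Set c

  _⊆_ : Subset → Subset → Set c
  S ⊆ T = ∀ x → S x → T x

  _≐_ : Subset → Subset → Set c
  S ≐ T = (S ⊆ T) × (T ⊆ S)

  ｛_｝ : Carrier → Subset
  ｛ a ｝ x = x ≡ a

  _∪_ : Subset → Subset → Subset
  (S ∪ T) x = S x ⊎ T x

  _∩_ : Subset → Subset → Subset
  (S ∩ T) x = S x × T x

  Whole : Subset
  Whole _ = ⊤

  record IsFilter (F : Subset) : Set c where
    field
      nonempty : Σ Carrier F
      ⊙-closed : ∀ {x y} → F x → F y → F (x ⊙ y)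
      up-closed : ∀ {x y} → F x → x ≤ y → F y

  IsGeneratedBy : Subset → Subset → Set (suc c)
  IsGeneratedBy F S =
    IsFilter F × (S ⊆ F) × (∀ (G : Subset) → IsFilter G → S ⊆ G → F ⊆ G)

  IsPrincipal : Subset → Carrier → Set (suc c)
  IsPrincipal F x = IsGeneratedBy F ｛ x ｝

  IsDirectSum : Subset → Subset → Subset → Set (suc c)
  IsDirectSum H F G = ((F ∩ G) ≐ ｛ 𝟙 ｝) × IsGeneratedBy H (F ∪ G)

{-# OPTIONS --safe #-}
-- A complemented element e is idempotent, so [e) is simply the up-set of e; since
-- e ∨ e* = 𝟙 and e ⊙ e* = 𝟘, the filters [e) and [e*) meet in 𝟙 and join to all of L.
-- Conversely, if L = F ⊕ G then 𝟘 ≥ f ⊙ g for some f ∈ F, g ∈ G. Disjointness gives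
-- x ∨ g = 𝟙 for every x ∈ F, and this together with f ⊙ g = 𝟘 forces f ≤ x; hence
-- F = [f), symmetrically G = [g), and f ∨ g = 𝟙 makes g the complement f* of f.
-- The last claim holds because a filter has at most one idempotent generator.
module Submission where

open import Defs
open import Level using (Level; suc)
open import Data.Product using (Σ; _×_; _,_; proj₁)
open import Data.Sum using (inj₁; inj₂)
open import Data.Unit.Polymorphic using (tt)
open import Function.Bundles using (_⇔_; mk⇔)
open import Relation.Binary.PropositionalEquality
  using (_≡_; refl; sym; trans; cong; cong₂; subst; isEquivalence)
open import Relation.Binary.Bundles using (Poset)
open import Algebra.Bundles using (CommutativeSemigroup)
open import Algebra.Lattice.Bundles using (Lattice)
import Algebra.Properties.CommutativeSemigroup as CommutativeSemigroupProperties
import Algebra.Lattice.Properties.Lattice as LatticeProperties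
import Relation.Binary.Lattice as OrderTheoretic
import Relation.Binary.Reasoning.PartialOrder as PartialOrderReasoning

module ResiduatedLatticeProperties {c : Level} (L : ResiduatedLattice c) where
  open ResiduatedLattice L

  lattice : Lattice c c
  lattice = record
    { Carrier = Carrier
    ; _≈_ = _≡_
    ; _∨_ = _∨_
    ; _∧_ = _∧_
    ; isLattice = record
      { isEquivalence = isEquivalence
      ; ∨-comm = ∨-comm
      ; ∨-assoc = ∨-assoc
      ; ∨-cong = cong₂ _∨_
      ; ∧-comm = ∧-comm
      ; ∧-assoc = ∧-assoc
      ; ∧-cong = cong₂ _∧_
      ; absorptive = ∨-absorb , ∧-absorb
      }
    }

  ⊙-commutativeSemigroup : CommutativeSemigroup c c
  ⊙-commutativeSemigroup = record
    { Carrier = Carrier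
    ; _≈_ = _≡_
    ; _∙_ = _⊙_
    ; isCommutativeSemigroup = record
      { isSemigroup = record
        { isMagma = record { isEquivalence = isEquivalence ; ∙-cong = cong₂ _⊙_ }
        ; assoc = ⊙-assoc
        }
      ; comm = ⊙-comm
      }
    }

  open CommutativeSemigroupProperties ⊙-commutativeSemigroup using (interchange)

  -- The library orders a lattice by x ≈ x ∧ y, whereas Defs uses x ∧ y ≡ x.
  private
    module Order = OrderTheoretic.Lattice
      (LatticeProperties.∨-∧-orderTheoreticLattice lattice)

  ≤-reflexive : ∀ {x y} → x ≡ y → x ≤ y
  ≤-reflexive x≡y = sym (Order.reflexive x≡y)

  ≤-refl : ∀ {x} → x ≤ x
  ≤-refl = sym Order.refl

  ≤-trans : ∀ {x y z} → x ≤ y → y ≤ z → x ≤ z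
  ≤-trans x≤y y≤z = sym (Order.trans (sym x≤y) (sym y≤z))

  ≤-antisym : ∀ {x y} → x ≤ y → y ≤ x → x ≡ y
  ≤-antisym x≤y y≤x = Order.antisym (sym x≤y) (sym y≤x)

  x≤x∨y : ∀ x y → x ≤ x ∨ y
  x≤x∨y x y = sym (Order.x≤x∨y x y)

  y≤x∨y : ∀ x y → y ≤ x ∨ y
  y≤x∨y x y = sym (Order.y≤x∨y x y)

  ∨-least : ∀ {x y z} → x ≤ z → y ≤ z → x ∨ y ≤ z
  ∨-least x≤z y≤z = sym (Order.∨-least (sym x≤z) (sym y≤z))

  x∧y≤x : ∀ x y → x ∧ y ≤ x
  x∧y≤x x y = sym (Order.x∧y≤x x y)

  x∧y≤y : ∀ x y → x ∧ y ≤ y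
  x∧y≤y x y = sym (Order.x∧y≤y x y)

  ∧-greatest : ∀ {x y z} → x ≤ y → x ≤ z → x ≤ y ∧ z
  ∧-greatest x≤y x≤z = sym (Order.∧-greatest (sym x≤y) (sym x≤z))

  ≤-poset : Poset c c c
  ≤-poset = record
    { _≤_ = _≤_
    ; isPartialOrder = record
      { isPreorder = record
        { isEquivalence = isEquivalence
        ; reflexive = ≤-reflexive
        ; trans = ≤-trans
        }
      ; antisym = ≤-antisym
      }
    }

  open PartialOrderReasoning ≤-poset

  ⊙-monoʳ-≤ : ∀ z {x y} → x ≤ y → z ⊙ x ≤ z ⊙ y
  ⊙-monoʳ-≤ z {x} {y} x≤y =
    residuation⇐ z (z ⊙ y) x (≤-trans x≤y (residuation⇒ z (z ⊙ y) y ≤-refl))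

  ⊙-monoˡ-≤ : ∀ z {x y} → x ≤ y → x ⊙ z ≤ y ⊙ z
  ⊙-monoˡ-≤ z {x} {y} x≤y = begin
    x ⊙ z  ≡⟨ ⊙-comm x z ⟩
    z ⊙ x  ≤⟨ ⊙-monoʳ-≤ z x≤y ⟩
    z ⊙ y  ≡⟨ ⊙-comm z y ⟩
    y ⊙ z  ∎

  ⊙-mono-≤ : ∀ {x y u v} → x ≤ y → u ≤ v → x ⊙ u ≤ y ⊙ v
  ⊙-mono-≤ {x} {y} {u} {v} x≤y u≤v = begin
    x ⊙ u  ≤⟨ ⊙-monoˡ-≤ u x≤y ⟩
    y ⊙ u  ≤⟨ ⊙-monoʳ-≤ y u≤v ⟩
    y ⊙ v  ∎

  x⊙y≤x : ∀ x y → x ⊙ y ≤ x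
  x⊙y≤x x y = begin
    x ⊙ y  ≤⟨ ⊙-monoʳ-≤ x (𝟙-greatest y) ⟩
    x ⊙ 𝟙  ≡⟨ ⊙-identityʳ x ⟩
    x      ∎

  x⊙y≤y : ∀ x y → x ⊙ y ≤ y
  x⊙y≤y x y = ≤-trans (≤-reflexive (⊙-comm x y)) (x⊙y≤x y x)

  x⊙y≤x∧y : ∀ x y → x ⊙ y ≤ x ∧ y
  x⊙y≤x∧y x y = ∧-greatest (x⊙y≤x x y) (x⊙y≤y x y)

  x⊙x*≤𝟘 : ∀ x → x ⊙ x * ≤ 𝟘
  x⊙x*≤𝟘 x = residuation⇐ x 𝟘 (x *) ≤-refl

  x*⊙x≤𝟘 : ∀ x → x * ⊙ x ≤ 𝟘
  x*⊙x≤𝟘 x = ≤-trans (≤-reflexive (⊙-comm (x *) x)) (x⊙x*≤𝟘 x)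

  -- a ⊙_ is a left adjoint, so it preserves the join x ∨ y = 𝟙.
  ≤-by-cover : ∀ {x y a z} → x ∨ y ≡ 𝟙 → a ⊙ x ≤ z → a ⊙ y ≤ z → a ≤ z
  ≤-by-cover {x} {y} {a} {z} x∨y≡𝟙 a⊙x≤z a⊙y≤z = begin
    a            ≡⟨ sym (⊙-identityʳ a) ⟩
    a ⊙ 𝟙        ≡⟨ cong (a ⊙_) (sym x∨y≡𝟙) ⟩
    a ⊙ (x ∨ y)  ≤⟨ residuation⇐ a z (x ∨ y)
                      (∨-least (residuation⇒ a z x a⊙x≤z) (residuation⇒ a z y a⊙y≤z)) ⟩
    z            ∎

  annihilator≤ : ∀ {x y a} → x ∨ y ≡ 𝟙 → a ⊙ y ≤ 𝟘 → a ≤ x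
  annihilator≤ {x} {y} {a} x∨y≡𝟙 a⊙y≤𝟘 =
    ≤-by-cover x∨y≡𝟙 (x⊙y≤y a x) (≤-trans a⊙y≤𝟘 (𝟘-least x))

  ∨≡𝟙⇒∧≤⊙ : ∀ {x y} → x ∨ y ≡ 𝟙 → x ∧ y ≤ x ⊙ y
  ∨≡𝟙⇒∧≤⊙ {x} {y} x∨y≡𝟙 = ≤-by-cover x∨y≡𝟙
    (≤-trans (⊙-monoˡ-≤ x (x∧y≤y x y)) (≤-reflexive (⊙-comm y x)))
    (⊙-monoˡ-≤ y (x∧y≤x x y))

  ∧≡𝟘⇒⊙≤𝟘 : ∀ {x y} → x ∧ y ≡ 𝟘 → x ⊙ y ≤ 𝟘
  ∧≡𝟘⇒⊙≤𝟘 {x} {y} x∧y≡𝟘 = ≤-trans (x⊙y≤x∧y x y) (≤-reflexive x∧y≡𝟘)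

  complement-intro : ∀ {e e'} → e ⊙ e' ≤ 𝟘 → e ∨ e' ≡ 𝟙 → InB e
  complement-intro {e} {e'} e⊙e'≤𝟘 e∨e'≡𝟙 =
    e' , ≤-antisym (≤-trans (∨≡𝟙⇒∧≤⊙ e∨e'≡𝟙) e⊙e'≤𝟘) (𝟘-least (e ∧ e')) , e∨e'≡𝟙

  complement-unique : ∀ {e e'} → e ⊙ e' ≤ 𝟘 → e ∨ e' ≡ 𝟙 → e' ≡ e *
  complement-unique {e} {e'} e⊙e'≤𝟘 e∨e'≡𝟙 = ≤-antisym
    (residuation⇒ e 𝟘 e' e⊙e'≤𝟘)
    (annihilator≤ (trans (∨-comm e' e) e∨e'≡𝟙) (x*⊙x≤𝟘 e))

  InB⇒∨*≡𝟙 : ∀ {e} → InB e → e ∨ e * ≡ 𝟙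
  InB⇒∨*≡𝟙 {e} (e' , e∧e'≡𝟘 , e∨e'≡𝟙) =
    subst (λ t → e ∨ t ≡ 𝟙) (complement-unique (∧≡𝟘⇒⊙≤𝟘 e∧e'≡𝟘) e∨e'≡𝟙) e∨e'≡𝟙

  InB-* : ∀ {e} → InB e → InB (e *)
  InB-* {e} e∈B = complement-intro (x*⊙x≤𝟘 e) (trans (∨-comm (e *) e) (InB⇒∨*≡𝟙 e∈B))

  InB⇒⊙-idem : ∀ {e} → InB e → e ⊙ e ≡ e
  InB⇒⊙-idem {e} (e' , e∧e'≡𝟘 , e∨e'≡𝟙) = ≤-antisym (x⊙y≤x e e)
    (≤-by-cover e∨e'≡𝟙 ≤-refl (≤-trans (∧≡𝟘⇒⊙≤𝟘 e∧e'≡𝟘) (𝟘-least (e ⊙ e))))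

  filter∋𝟙 : ∀ {F} → IsFilter F → F 𝟙
  filter∋𝟙 F-filter =
    let (x , x∈F) = IsFilter.nonempty F-filter in IsFilter.up-closed F-filter x∈F (𝟙-greatest x)

  Whole-isFilter : IsFilter Whole
  Whole-isFilter = record
    { nonempty = 𝟙 , tt
    ; ⊙-closed = λ _ _ → tt
    ; up-closed = λ _ _ → tt
    }

  filter∋𝟘⇒Whole⊆ : ∀ {F} → IsFilter F → F 𝟘 → Whole ⊆ F
  filter∋𝟘⇒Whole⊆ F-filter 𝟘∈F x _ = IsFilter.up-closed F-filter 𝟘∈F (𝟘-least x)

  ↑ : Carrier → Subset
  ↑ a x = a ≤ x

  ↑-isFilter : ∀ {a} → a ⊙ a ≡ a → IsFilter (↑ a)
  ↑-isFilter {a} a⊙a≡a = record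
    { nonempty = a , ≤-refl
    ; ⊙-closed = λ {x} {y} a≤x a≤y → begin
        a      ≡⟨ sym a⊙a≡a ⟩
        a ⊙ a  ≤⟨ ⊙-mono-≤ a≤x a≤y ⟩
        x ⊙ y  ∎
    ; up-closed = ≤-trans
    }

  principal∋generator : ∀ {F a} → IsPrincipal F a → F a
  principal∋generator (_ , a∈F , _) = a∈F _ refl

  principal⊆↑ : ∀ {F a} → a ⊙ a ≡ a → IsPrincipal F a → F ⊆ ↑ a
  principal⊆↑ {a = a} a⊙a≡a (_ , _ , least) =
    least (↑ a) (↑-isFilter a⊙a≡a) λ { _ refl → ≤-refl }

  principal-intro : ∀ {F a} → IsFilter F → F a → F ⊆ ↑ a → IsPrincipal F a
  principal-intro {a = a} F-filter a∈F F⊆↑a =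
    F-filter , (λ { _ refl → a∈F }) ,
    λ G G-filter a∈G x x∈F → IsFilter.up-closed G-filter (a∈G a refl) (F⊆↑a x x∈F)

  principal-unique : ∀ {F a b} → a ⊙ a ≡ a → b ⊙ b ≡ b →
                     IsPrincipal F a → IsPrincipal F b → a ≡ b
  principal-unique a⊙a≡a b⊙b≡b a-generates b-generates = ≤-antisym
    (principal⊆↑ a⊙a≡a a-generates _ (principal∋generator b-generates))
    (principal⊆↑ b⊙b≡b b-generates _ (principal∋generator a-generates))

  record _⊙ᶠ_ (F G : Subset) (x : Carrier) : Set c where
    constructor factor
    field
      {f g} : Carrier
      f∈F : F f
      g∈G : G g
      f⊙g≤x : f ⊙ g ≤ x

  module _ {F G : Subset} (F-filter : IsFilter F) (G-filter : IsFilter G) where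

    ⊙ᶠ-isFilter : IsFilter (F ⊙ᶠ G)
    ⊙ᶠ-isFilter = record
      { nonempty = 𝟙 , factor (filter∋𝟙 F-filter) (filter∋𝟙 G-filter) (𝟙-greatest (𝟙 ⊙ 𝟙))
      ; ⊙-closed = λ (factor {f} {g} f∈F g∈G fg≤x) (factor {f'} {g'} f'∈F g'∈G f'g'≤y) →
          factor (IsFilter.⊙-closed F-filter f∈F f'∈F) (IsFilter.⊙-closed G-filter g∈G g'∈G)
            (≤-trans (≤-reflexive (interchange f f' g g')) (⊙-mono-≤ fg≤x f'g'≤y))
      ; up-closed = λ (factor f∈F g∈G fg≤x) x≤y → factor f∈F g∈G (≤-trans fg≤x x≤y)
      }

    ∪⊆⊙ᶠ : (F ∪ G) ⊆ (F ⊙ᶠ G)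
    ∪⊆⊙ᶠ x (inj₁ x∈F) = factor x∈F (filter∋𝟙 G-filter) (≤-reflexive (⊙-identityʳ x))
    ∪⊆⊙ᶠ x (inj₂ x∈G) =
      factor (filter∋𝟙 F-filter) x∈G (≤-reflexive (trans (⊙-comm 𝟙 x) (⊙-identityʳ x)))

    generated-by-∪⊆⊙ᶠ : ∀ {H} → IsGeneratedBy H (F ∪ G) → H ⊆ (F ⊙ᶠ G)
    generated-by-∪⊆⊙ᶠ (_ , _ , least) = least (F ⊙ᶠ G) ⊙ᶠ-isFilter ∪⊆⊙ᶠ

  InB-principal-unique : ∀ {F a b} → InB a → InB b →
                         IsPrincipal F a → IsPrincipal F b → a ≡ b
  InB-principal-unique a∈B b∈B = principal-unique (InB⇒⊙-idem a∈B) (InB⇒⊙-idem b∈B)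

  module _ {F G : Subset} (F-filter : IsFilter F) (G-filter : IsFilter G)
           (F∩G⊆𝟙 : (F ∩ G) ⊆ ｛ 𝟙 ｝) where

    disjoint⇒∨≡𝟙 : ∀ {x y} → F x → G y → x ∨ y ≡ 𝟙
    disjoint⇒∨≡𝟙 {x} {y} x∈F y∈G = F∩G⊆𝟙 (x ∨ y)
      ( IsFilter.up-closed F-filter x∈F (x≤x∨y x y)
      , IsFilter.up-closed G-filter y∈G (y≤x∨y x y))

    annihilating-pair⇒principal : ∀ {f g} → F f → G g → f ⊙ g ≤ 𝟘 → IsPrincipal F f
    annihilating-pair⇒principal f∈F g∈G f⊙g≤𝟘 = principal-intro F-filter f∈F
      λ x x∈F → annihilator≤ (disjoint⇒∨≡𝟙 x∈F g∈G) f⊙g≤𝟘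

  ComplementaryPrincipal : Subset → Subset → Set (suc c)
  ComplementaryPrincipal F G = Σ Carrier λ e → InB e × IsPrincipal F e × IsPrincipal G (e *)

  ⊕⇒complementaryPrincipal : ∀ {F G} → IsFilter F → IsFilter G →
                             IsDirectSum Whole F G → ComplementaryPrincipal F G
  ⊕⇒complementaryPrincipal {F} {G} F-filter G-filter ((F∩G⊆𝟙 , _) , Whole-generated) =
    f , complement-intro f⊙g≤𝟘 f∨g≡𝟙 ,
    annihilating-pair⇒principal F-filter G-filter F∩G⊆𝟙 f∈F g∈G f⊙g≤𝟘 ,
    subst (IsPrincipal G) (complement-unique f⊙g≤𝟘 f∨g≡𝟙)
      (annihilating-pair⇒principal G-filter F-filter G∩F⊆𝟙 g∈G f∈F g⊙f≤𝟘)
    where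
    open _⊙ᶠ_ (generated-by-∪⊆⊙ᶠ F-filter G-filter Whole-generated 𝟘 tt)
      renaming (f⊙g≤x to f⊙g≤𝟘)

    G∩F⊆𝟙 : (G ∩ F) ⊆ ｛ 𝟙 ｝
    G∩F⊆𝟙 x (x∈G , x∈F) = F∩G⊆𝟙 x (x∈F , x∈G)

    g⊙f≤𝟘 : g ⊙ f ≤ 𝟘
    g⊙f≤𝟘 = ≤-trans (≤-reflexive (⊙-comm g f)) f⊙g≤𝟘

    f∨g≡𝟙 : f ∨ g ≡ 𝟙
    f∨g≡𝟙 = disjoint⇒∨≡𝟙 F-filter G-filter F∩G⊆𝟙 f∈F g∈G

  complementaryPrincipal⇒⊕ : ∀ {F G} → ComplementaryPrincipal F G → IsDirectSum Whole F G
  complementaryPrincipal⇒⊕ {F} {G} (e , e∈B , e-generates , e*-generates) =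
    (F∩G⊆𝟙 , 𝟙∈F∩G) , Whole-isFilter , (λ _ _ → tt) , Whole-least
    where
    F∩G⊆𝟙 : (F ∩ G) ⊆ ｛ 𝟙 ｝
    F∩G⊆𝟙 x (x∈F , x∈G) = ≤-antisym (𝟙-greatest x) (begin
      𝟙        ≡⟨ sym (InB⇒∨*≡𝟙 e∈B) ⟩
      e ∨ e *  ≤⟨ ∨-least (principal⊆↑ (InB⇒⊙-idem e∈B) e-generates x x∈F)
                          (principal⊆↑ (InB⇒⊙-idem (InB-* e∈B)) e*-generates x x∈G) ⟩
      x        ∎)

    𝟙∈F∩G : ｛ 𝟙 ｝ ⊆ (F ∩ G)
    𝟙∈F∩G _ refl = filter∋𝟙 (proj₁ e-generates) , filter∋𝟙 (proj₁ e*-generates)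

    Whole-least : ∀ H → IsFilter H → (F ∪ G) ⊆ H → Whole ⊆ H
    Whole-least H H-filter F∪G⊆H = filter∋𝟘⇒Whole⊆ H-filter
      (IsFilter.up-closed H-filter
        (IsFilter.⊙-closed H-filter
          (F∪G⊆H e (inj₁ (principal∋generator e-generates)))
          (F∪G⊆H (e *) (inj₂ (principal∋generator e*-generates))))
        (x⊙x*≤𝟘 e))

  principal-summands⇒complement : ∀ {e f E F} → InB e → InB f →
    IsPrincipal E e → IsPrincipal F f → IsDirectSum Whole E F → f ≡ e *
  principal-summands⇒complement e∈B f∈B e-generates f-generates E⊕F =
    let (d , d∈B , d-generates , d*-generates) =
          ⊕⇒complementaryPrincipal (proj₁ e-generates) (proj₁ f-generates) E⊕F
    in trans (InB-principal-unique f∈B (InB-* d∈B) f-generates d*-generates)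
             (cong _* (InB-principal-unique d∈B e∈B d-generates e-generates))

proposition3p7 : ∀ {c : Level} (L : ResiduatedLattice c) →
    let open ResiduatedLattice L in
    (∀ (F G : Subset) → IsFilter F → IsFilter G →
      (IsDirectSum Whole F G ⇔
        Σ Carrier λ e → InB e × IsPrincipal F e × IsPrincipal G (e *)))
    × (∀ (e f : Carrier) (E Fe : Subset) → InB e → InB f →
      IsPrincipal E e → IsPrincipal Fe f → IsDirectSum Whole E Fe → f ≡ e *)
proposition3p7 L =
  (λ F G F-filter G-filter →
     mk⇔ (⊕⇒complementaryPrincipal F-filter G-filter) complementaryPrincipal⇒⊕) ,
  (λ e f E F → principal-summands⇒complement)
  where open ResiduatedLatticeProperties L
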